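{- The sets $C(H,u)$, where $H$ ranges over hyperplanes of $T$ and $u$ over elements of $V'$ with $ru\notin H$, form a (uniquely determined) partition of the common vertex set $V$ of the graphs $X(2e,K)$ and $Y(2e,K)$. Each class of this partition has size $q^{2e-1}$, and the number of classes is $\frac{q^{2e}-1}{q-1}$.
   Context: Let $e\geq 2$ and let $K$ be a finite commutative ring with identity having precisely three ideals $\{0\}$, $J=\langle r\rangle$, $K$, with $K/J\cong\mathbb{F}_q$ ($q$ a prime power). Let $K^\times$ be the set of units, $V'$ the set of tuples in $K^{2e}$ with at least one entry in $K^\times$, for $a\in V'$ let $[a]=\{\lambda a:\lambda\in K^\times\}$, and let $V=\{[a]:a\in V'\}$. The graphs $X(2e,K)$ and $Y(2e,K)$ have vertex set $V$ (with adjacency defined via $\langle a,b\rangle=\sum_{i=1}^e(a_ib_{e+i}-a_{e+i}b_i)$ lying in $K\setminus\{0\}$, resp. $J\setminus\{0\}$). Let $T=J^{2e}$; it is a $2e$-dimensional vector space over $K/J$ with scalar multiplication $(z+J)\cdot x=zx$. A hyperplane is a $(2e-1)$-dimensional subspace of $T$. For $u\in K^{2e}$, $ru$ denotes the componentwise product, an element of $T$. For a hyperplane $H$ and $u\in V'$ with $ru\notin H$, $C(H,u)=\{[u+h]: h\in H\}$. -}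

module Defs where

open import Level using (Level; _⊔_; Lift)
open import Algebra.Bundles using (CommutativeRing)
open import Data.Nat as ℕ using (ℕ; suc; zero)
open import Data.Fin as F using (Fin)
open import Data.List using (List; length)
open import Data.List.Relation.Unary.All using (All)
open import Data.List.Relation.Unary.Any using (Any)
open import Data.List.Relation.Unary.AllPairs using (AllPairs)
open import Data.Product using (Σ; ∃; _×_; _,_)
open import Data.Sum using (_⊎_)
open import Data.Unit.Polymorphic using (⊤)
open import Relation.Nullary using (¬_)
open import Relation.Binary.Definitions using (Decidable)
open import Relation.Binary.PropositionalEquality using (_≡_)

HasSize : ∀ {a b p} (A : Set a) (_~_ : A → A → Set b) (P : A → Set p) → ℕ →
          Set (a ⊔ b ⊔ p)
HasSize A _~_ P n =
  Σ (List A) λ xs →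
    length xs ≡ n × All P xs × AllPairs (λ x y → ¬ (x ~ y)) xs ×
    (∀ x → P x → Any (x ~_) xs)

SameSet : ∀ {a p q} {A : Set a} → (A → Set p) → (A → Set q) → Set (a ⊔ p ⊔ q)
SameSet P Q = ∀ x → (P x → Q x) × (Q x → P x)

module Ring {c ℓ} (R : CommutativeRing c ℓ) where
  open CommutativeRing R

  ℓ' : Level
  ℓ' = c ⊔ ℓ

  Finite : Set ℓ'
  Finite = Decidable _≈_ × Σ (List Carrier) λ xs → ∀ x → Any (x ≈_) xs

  record IsIdeal (I : Carrier → Set ℓ') : Set ℓ' where
    field
      resp  : ∀ {x y} → x ≈ y → I x → I y
      zero∈ : I 0#
      +∈    : ∀ {x y} → I x → I y → I (x + y)
      *∈    : ∀ k {x} → I x → I (k * x)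

  ZeroIdeal : Carrier → Set ℓ'
  ZeroIdeal x = Lift ℓ' (x ≈ 0#)

  ⟨_⟩ : Carrier → Carrier → Set ℓ'
  ⟨ r ⟩ x = Lift ℓ' (∃ λ k → x ≈ k * r)

  WholeRing : Carrier → Set ℓ'
  WholeRing _ = ⊤ {ℓ'}

  PreciselyThreeIdeals : Carrier → Set (Level.suc ℓ')
  PreciselyThreeIdeals r =
    (∀ I → IsIdeal I →
       SameSet I ZeroIdeal ⊎ SameSet I ⟨ r ⟩ ⊎ SameSet I WholeRing) ×
    ¬ SameSet ZeroIdeal ⟨ r ⟩ × ¬ SameSet ⟨ r ⟩ WholeRing ×
    ¬ SameSet ZeroIdeal WholeRing

  -- |K/J| = q, where J = ⟨r⟩ (cosets x + J counted)
  QuotientSize : Carrier → ℕ → Set ℓ'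
  QuotientSize r q = HasSize Carrier (λ x y → ⟨ r ⟩ (x - y)) (λ _ → ⊤ {ℓ'}) q

  IsUnit : Carrier → Set ℓ'
  IsUnit x = Lift ℓ' (∃ λ y → x * y ≈ 1#)

  Vec : ℕ → Set c
  Vec n = Fin n → Carrier

  V' : ∀ {n} → Vec n → Set ℓ'
  V' a = ∃ λ i → IsUnit (a i)

  -- a ~ b  iff  [a] = [b], i.e. b = λ a for a unit λ
  _~_ : ∀ {n} → Vec n → Vec n → Set ℓ'
  a ~ b = ∃ λ t → IsUnit t × (∀ i → Lift c (b i ≈ t * a i))

  _≋_ : ∀ {n} → Vec n → Vec n → Set ℓ'
  a ≋ b = ∀ i → Lift c (a i ≈ b i)

  _⊕_ : ∀ {n} → Vec n → Vec n → Vec n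
  (a ⊕ b) i = a i + b i

  _⊙_ : ∀ {n} → Carrier → Vec n → Vec n
  (z ⊙ a) i = z * a i

  𝟎 : ∀ {n} → Vec n
  𝟎 _ = 0#

  -- Σ_{j<d} c_j b_j  (K/J-scalars represented by elements of K)
  lincomb : ∀ {n d} → (Fin d → Carrier) → (Fin d → Vec n) → Vec n
  lincomb {d = zero}  cs bs = 𝟎
  lincomb {d = suc d} cs bs =
    (cs F.zero ⊙ bs F.zero) ⊕ lincomb (λ j → cs (F.suc j)) (λ j → bs (F.suc j))

  T : ∀ {n} → Carrier → Vec n → Set ℓ'
  T r x = ∀ i → ⟨ r ⟩ (x i)

  -- K/J-subspace of T (scalar (z + J)·x = z x)
  record IsSubspace {n} (r : Carrier) (H : Vec n → Set ℓ') : Set ℓ' where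
    field
      ⊆T    : ∀ {x} → H x → T r x
      resp  : ∀ {x y} → x ≋ y → H x → H y
      zero∈ : H 𝟎
      +∈    : ∀ {x y} → H x → H y → H (x ⊕ y)
      ·∈    : ∀ z {x} → H x → H (z ⊙ x)

  -- H has dimension d over K/J: a basis of d vectors of H,
  -- linearly independent over K/J (coefficients vanish mod J) and spanning H
  HasDimension : ∀ {n} → Carrier → (Vec n → Set ℓ') → ℕ → Set ℓ'
  HasDimension r H d =
    Σ (Fin d → _) λ bs →
      (∀ j → H (bs j)) ×
      (∀ (cs : Fin d → Carrier) → lincomb cs bs ≋ 𝟎 → ∀ j → ⟨ r ⟩ (cs j)) ×
      (∀ h → H h → ∃ λ (cs : Fin d → Carrier) → h ≋ lincomb cs bs)

  IsHyperplane : ∀ {n} → Carrier → (Vec n → Set ℓ') → Set ℓ'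
  IsHyperplane {n} r H = IsSubspace r H × HasDimension r H (n ℕ.∸ 1)

  Index : ℕ → Carrier → Set (Level.suc ℓ')
  Index n r = Σ (Vec n → Set ℓ') λ H → IsHyperplane r H ×
              Σ (Vec n) λ u → V' u × ¬ H (r ⊙ u)

  -- C(H,u) = { [u + h] : h ∈ H }, as a (~-invariant) predicate on tuples
  C : ∀ {n r} → Index n r → Vec n → Set ℓ'
  C (H , _ , u , _) x = ∃ λ h → H h × (u ⊕ h) ~ x

{-# OPTIONS --safe #-}

-- K is local with maximal ideal J = ⟨r⟩, and J² = 0 since ⟨r²⟩ can be neither K nor J.
-- For a hyperplane H of T = J^n with ru ∉ H, counting gives T = H ⊕ (K/J)·ru: the map
-- (h, s) ↦ h + s·ru is injective on the q^n coefficient tuples, and T has at most q^n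
-- elements. Using J² = 0 it follows that [x] ∈ C(H,u) iff x ≡ μu (mod J) for a unit μ,
-- so the classes are the fibres of reduction mod J onto the projective space over K/J,
-- whose points are counted by normalising the first unit coordinate. Within a class,
-- [u + h] = [u + h′] forces h = h′, so the class is parametrised by H. Every vertex [a]
-- lies in the class of the coordinate hyperplane x_k = 0, where a_k is a unit.

module Submission where

open import Defs
open import Level using (Lift; lift; lower)
open import Algebra.Bundles using (CommutativeRing)
open import Data.Nat as Nat using (ℕ; zero; suc; s≤s)
import Data.Nat.Properties as ℕₚ
open import Data.Fin as Fin using (Fin; punchIn; punchOut)
import Data.Fin.Properties as Finₚ
open import Data.Vec.Functional using (Vector; tail) renaming (_∷_ to _◂_)
open import Data.List using (List; []; _∷_; _++_; map; length; lookup; cartesianProductWith)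
open import Data.List.Properties using (length-map; length-++)
open import Data.List.Membership.Propositional.Properties using (∈-lookup)
open import Data.List.Relation.Unary.All as All using (All; []; _∷_)
import Data.List.Relation.Unary.All.Properties as Allₚ
open import Data.List.Relation.Unary.Any as Any using (Any; here)
import Data.List.Relation.Unary.Any.Properties as Anyₚ
open import Data.List.Relation.Unary.AllPairs as AllPairs using (AllPairs; []; _∷_)
import Data.List.Relation.Unary.AllPairs.Properties as AllPairsₚ
open import Data.Product using (Σ; ∃; _×_; _,_; proj₁; proj₂)
open import Data.Sum using (_⊎_; inj₁; inj₂)
open import Data.Unit.Polymorphic using (⊤; tt)
open import Data.Empty using (⊥; ⊥-elim)
open import Function using (_∘_)
open import Relation.Nullary using (¬_; Dec; yes; no; ¬?; _×-dec_)
open import Relation.Binary.Definitions using (Symmetric; Transitive; Decidable)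
open import Relation.Binary.PropositionalEquality as ≡ using (_≡_; _≢_)

module _ {a} {A : Set a} where

  length-cartesianProductWith : ∀ {b c} {B : Set b} {C : Set c} (f : A → B → C) xs ys →
    length (cartesianProductWith f xs ys) ≡ length xs Nat.* length ys
  length-cartesianProductWith f []       ys = ≡.refl
  length-cartesianProductWith f (x ∷ xs) ys = ≡.trans (length-++ (map (f x) ys))
    (≡.cong₂ Nat._+_ (length-map (f x) ys) (length-cartesianProductWith f xs ys))

  tuples : List A → (d : ℕ) → List (Vector A d)
  tuples xs zero    = (λ ()) ∷ []
  tuples xs (suc d) = cartesianProductWith _◂_ xs (tuples xs d)

  length-tuples : ∀ xs d → length (tuples xs d) ≡ length xs Nat.^ d
  length-tuples xs zero    = ≡.refl
  length-tuples xs (suc d) = ≡.trans (length-cartesianProductWith _◂_ xs (tuples xs d))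
    (≡.cong (length xs Nat.*_) (length-tuples xs d))

  tuples-complete : ∀ {p} (R : A → A → Set p) xs {d} (v : Vector A d) →
    (∀ j → Any (R (v j)) xs) → Any (λ w → ∀ j → R (v j) (w j)) (tuples xs d)
  tuples-complete R xs {zero}  v _   = here (λ ())
  tuples-complete R xs {suc d} v cov = Anyₚ.cartesianProductWith⁺ _◂_ cons (cov Fin.zero)
    (tuples-complete R xs (tail v) (cov ∘ Fin.suc))
    where
    cons : ∀ {x w} → R (v Fin.zero) x → (∀ j → R (tail v j) (w j)) → ∀ j → R (v j) ((x ◂ w) j)
    cons R₀ R₊ Fin.zero    = R₀
    cons R₀ R₊ (Fin.suc j) = R₊ j

  Apart : ∀ {p} → (A → A → Set p) → ∀ {d} → Vector A d → Vector A d → Set p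
  Apart S v w = ∃ λ j → S (v j) (w j)

  tuples-apart : ∀ {p} (S : A → A → Set p) {xs} → AllPairs S xs → ∀ d → AllPairs (Apart S) (tuples xs d)
  tuples-apart S xs! zero    = [] ∷ []
  tuples-apart S xs! (suc d) = apart xs!
    where
    ys = tuples _ d
    ys! = tuples-apart S xs! d
    heads : ∀ {x zs} w → All (S x) zs → All (Apart S (x ◂ w)) (cartesianProductWith _◂_ zs ys)
    heads w []         = []
    heads w (s ∷ Sxzs) = Allₚ.++⁺ (Allₚ.map⁺ (All.universal (λ _ → Fin.zero , s) ys)) (heads w Sxzs)
    apart : ∀ {zs} → AllPairs S zs → AllPairs (Apart S) (cartesianProductWith _◂_ zs ys)
    apart []            = []
    apart (Sxzs ∷ zs!) = AllPairsₚ.++⁺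
      (AllPairsₚ.map⁺ (AllPairs.map (λ (j , s) → Fin.suc j , s) ys!))
      (apart zs!)
      (Allₚ.map⁺ (All.universal (λ w → heads w Sxzs) ys))

  AllPairs-lookup : ∀ {p} {S : A → A → Set p} {xs} → AllPairs S xs →
    ∀ {i j} → i Fin.< j → S (lookup xs i) (lookup xs j)
  AllPairs-lookup (Sx ∷ _)   {Fin.zero}  {Fin.suc j} _         = All.lookup Sx (∈-lookup j)
  AllPairs-lookup (_ ∷ xs!) {Fin.suc i} {Fin.suc j} (s≤s i<j) = AllPairs-lookup xs! i<j

module _ {a r} {A : Set a} {_∼_ : A → A → Set r}
         (∼-sym : Symmetric _∼_) (∼-trans : Transitive _∼_) (_∼?_ : Decidable _∼_) where

  pigeonhole-covers : ∀ {p} {P : A → Set p} {xs} ys → length ys ≡ length xs →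
    AllPairs (λ x y → ¬ x ∼ y) xs → All P xs → (∀ x → P x → Any (x ∼_) ys) →
    ∀ x → P x → Any (x ∼_) xs
  pigeonhole-covers {xs = xs} ys |ys|≡|xs| xs! Pxs ys-covers x Px with Any.any? (x ∼?_) xs
  ... | yes x∼xs = x∼xs
  ... | no  x≁xs = ⊥-elim collision
    where
    -- x ∷ xs is longer than ys, so two of its elements are covered by the same element of ys.
    zs = x ∷ xs
    zs! : AllPairs (λ x y → ¬ x ∼ y) zs
    zs! = Allₚ.¬Any⇒All¬ xs x≁xs ∷ xs!
    covered : ∀ i → Any (lookup zs i ∼_) ys
    covered i = ys-covers (lookup zs i) (All.lookup (Px ∷ Pxs) (∈-lookup i))
    f : Fin (length zs) → Fin (length ys)
    f i = Any.index (covered i)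
    ∼f : ∀ i → lookup zs i ∼ lookup ys (f i)
    ∼f i = Anyₚ.lookup-index (covered i)
    |ys|<|zs| : length ys Nat.< length zs
    |ys|<|zs| = s≤s (ℕₚ.≤-reflexive |ys|≡|xs|)
    collision : ⊥
    collision with i , j , i<j , fi≡fj ← Finₚ.pigeonhole |ys|<|zs| f =
      AllPairs-lookup zs! i<j (∼-trans (∼f i) (∼-sym (≡.subst (_ ∼_ ∘ lookup ys) (≡.sym fi≡fj) (∼f j))))

geometricSum : ℕ → ℕ → ℕ
geometricSum q zero    = 0
geometricSum q (suc m) = q Nat.^ m Nat.+ geometricSum q m

geometricSum-*-pred : ∀ p m → geometricSum (suc p) m Nat.* p ≡ suc p Nat.^ m Nat.∸ 1
geometricSum-*-pred p zero    = ≡.refl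
geometricSum-*-pred p (suc m) = begin
  (suc p ^ m + geometricSum (suc p) m) * p    ≡⟨ ℕₚ.*-distribʳ-+ p (suc p ^ m) _ ⟩
  suc p ^ m * p + geometricSum (suc p) m * p  ≡⟨ ≡.cong (suc p ^ m * p +_) (geometricSum-*-pred p m) ⟩
  suc p ^ m * p + (suc p ^ m ∸ 1)             ≡⟨ ℕₚ.+-∸-assoc (suc p ^ m * p) (ℕₚ.m^n>0 (suc p) m) ⟨
  (suc p ^ m * p + suc p ^ m) ∸ 1             ≡⟨ ≡.cong (_∸ 1) (ℕₚ.+-comm (suc p ^ m * p) (suc p ^ m)) ⟩
  (suc p ^ m + suc p ^ m * p) ∸ 1             ≡⟨ ≡.cong (λ y → (suc p ^ m + y) ∸ 1) (ℕₚ.*-comm (suc p ^ m) p) ⟩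
  suc p ^ suc m ∸ 1                           ∎
  where open ≡.≡-Reasoning; open Nat using (_+_; _*_; _^_; _∸_)

module CommutativeRingLemmas {c ℓ} (K : CommutativeRing c ℓ) where

  open CommutativeRing K
  open Ring K
  open import Algebra.Properties.Ring ring using (-‿+-comm; [y-z]x≈yx-zx)
  open import Relation.Binary.Reasoning.Setoid setoid
  open import Data.Maybe using (nothing)
  open import Tactic.RingSolver.Core.AlmostCommutativeRing using (fromCommutativeRing)
  open import Tactic.RingSolver.NonReflective (fromCommutativeRing K (λ _ → nothing))
    using (solve; _⊜_) renaming (_⊕_ to _:+_; _⊗_ to _:*_)

  sub-+-sub : ∀ x y z → (x - y) + (y - z) ≈ x - z
  sub-+-sub x y z = begin
    (x - y) + (y - z)   ≈⟨ solve 4 (λ x y -y -z → ((x :+ -y) :+ (y :+ -z)) ⊜ (x :+ ((-y :+ y) :+ -z)))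
                                   refl x y (- y) (- z) ⟩
    x + (- y + y - z)   ≈⟨ +-congˡ (+-congʳ (-‿inverseˡ y)) ⟩
    x + (0# - z)        ≈⟨ +-congˡ (+-identityˡ (- z)) ⟩
    x - z               ∎

  +-sub-cancelʳ : ∀ x y → (x + y) - y ≈ x
  +-sub-cancelʳ x y = begin
    (x + y) - y   ≈⟨ +-assoc x y (- y) ⟩
    x + (y - y)   ≈⟨ +-congˡ (-‿inverseʳ y) ⟩
    x + 0#        ≈⟨ +-identityʳ x ⟩
    x             ∎

  +-sub-+ : ∀ x y z w → (x + y) - (z + w) ≈ (x - z) + (y - w)
  +-sub-+ x y z w = begin
    (x + y) - (z + w)       ≈⟨ +-congˡ (-‿+-comm z w) ⟨
    (x + y) + (- z + - w)   ≈⟨ solve 4 (λ x y -z -w → ((x :+ y) :+ (-z :+ -w)) ⊜ ((x :+ -z) :+ (y :+ -w)))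
                                       refl x y (- z) (- w) ⟩
    (x - z) + (y - w)       ∎

  +≈+⇒-≈- : ∀ {x y z w} → x + y ≈ z + w → x - z ≈ w - y
  +≈+⇒-≈- {x} {y} {z} {w} x+y≈z+w = begin
    x - z                   ≈⟨ +-identityʳ (x - z) ⟨
    (x - z) + 0#            ≈⟨ +-congˡ (-‿inverseʳ y) ⟨
    (x - z) + (y - y)       ≈⟨ +-sub-+ x y z y ⟨
    (x + y) - (z + y)       ≈⟨ +-congʳ x+y≈z+w ⟩
    (z + w) - (z + y)       ≈⟨ +-sub-+ z w z y ⟩
    (z - z) + (w - y)       ≈⟨ +-congʳ (-‿inverseʳ z) ⟩
    0# + (w - y)            ≈⟨ +-identityˡ (w - y) ⟩
    w - y                   ∎

  +-sub-cancelˡ : ∀ x y → x + (y - x) ≈ y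
  +-sub-cancelˡ x y = begin
    x + (y - x)   ≈⟨ +-comm x (y - x) ⟩
    (y - x) + x   ≈⟨ +-assoc y (- x) x ⟩
    y + (- x + x) ≈⟨ +-congˡ (-‿inverseˡ x) ⟩
    y + 0#        ≈⟨ +-identityʳ y ⟩
    y             ∎

  +-sub-+-cancelˡ : ∀ x y z → (x + y) - (x + z) ≈ y - z
  +-sub-+-cancelˡ x y z = begin
    (x + y) - (x + z) ≈⟨ +-sub-+ x y x z ⟩
    (x - x) + (y - z) ≈⟨ +-congʳ (-‿inverseʳ x) ⟩
    0# + (y - z)      ≈⟨ +-identityˡ (y - z) ⟩
    y - z             ∎

  [1+sr][a+b]≈a+[b+s[ra]] : ∀ s r a b → (s * r) * b ≈ 0# → (1# + s * r) * (a + b) ≈ a + (b + s * (r * a))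
  [1+sr][a+b]≈a+[b+s[ra]] s r a b srb≈0 = begin
    (1# + s * r) * (a + b)                   ≈⟨ distribʳ (a + b) 1# (s * r) ⟩
    1# * (a + b) + (s * r) * (a + b)         ≈⟨ +-congʳ (*-identityˡ (a + b)) ⟩
    (a + b) + (s * r) * (a + b)              ≈⟨ +-congˡ (distribˡ (s * r) a b) ⟩
    (a + b) + ((s * r) * a + (s * r) * b)    ≈⟨ +-congˡ (+-congʳ (*-assoc s r a)) ⟩
    (a + b) + (s * (r * a) + (s * r) * b)    ≈⟨ solve 4 (λ a b x y → ((a :+ b) :+ (x :+ y)) ⊜ ((a :+ (b :+ x)) :+ y))
                                                        refl a b _ _ ⟩
    (a + (b + s * (r * a))) + (s * r) * b    ≈⟨ +-congˡ srb≈0 ⟩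
    (a + (b + s * (r * a))) + 0#             ≈⟨ +-identityʳ _ ⟩
    a + (b + s * (r * a))                    ∎

  principal : ∀ x → IsIdeal ⟨ x ⟩
  principal x = record
    { resp  = λ { y≈z (lift (k , y≈kx)) → lift (k , trans (sym y≈z) y≈kx) }
    ; zero∈ = lift (0# , sym (zeroˡ x))
    ; +∈    = λ { (lift (a , y≈ax)) (lift (b , z≈bx)) →
                  lift (a + b , trans (+-cong y≈ax z≈bx) (sym (distribʳ x a b))) }
    ; *∈    = λ { k (lift (a , y≈ax)) → lift (k * a , trans (*-congˡ y≈ax) (sym (*-assoc k a x))) }
    }

  x∈⟨x⟩ : ∀ x → ⟨ x ⟩ x
  x∈⟨x⟩ x = lift (1# , sym (*-identityˡ x))

  inverse : ∀ {x} → IsUnit x → Carrier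
  inverse = proj₁ ∘ lower

  inverse-cancelˡ : ∀ {x} (x-unit : IsUnit x) y → inverse x-unit * (x * y) ≈ y
  inverse-cancelˡ {x} (lift (x⁻¹ , xx⁻¹≈1)) y = begin
    x⁻¹ * (x * y) ≈⟨ *-assoc x⁻¹ x y ⟨
    (x⁻¹ * x) * y ≈⟨ *-congʳ (trans (*-comm x⁻¹ x) xx⁻¹≈1) ⟩
    1# * y        ≈⟨ *-identityˡ y ⟩
    y             ∎

  inverse-cancelʳ : ∀ {x} (x-unit : IsUnit x) y → x * (inverse x-unit * y) ≈ y
  inverse-cancelʳ {x} (lift (x⁻¹ , xx⁻¹≈1)) y =
    trans (sym (*-assoc x x⁻¹ y)) (trans (*-congʳ xx⁻¹≈1) (*-identityˡ y))

  inverse-unit : ∀ {x} (x-unit : IsUnit x) → IsUnit (inverse x-unit)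
  inverse-unit {x} (lift (x⁻¹ , xx⁻¹≈1)) = lift (x , trans (*-comm x⁻¹ x) xx⁻¹≈1)

  1-unit : IsUnit 1#
  1-unit = lift (1# , *-identityˡ 1#)

  *-unit : ∀ {x y} → IsUnit x → IsUnit y → IsUnit (x * y)
  *-unit {x} {y} (lift (x⁻¹ , xx⁻¹≈1)) (lift (y⁻¹ , yy⁻¹≈1)) = lift (x⁻¹ * y⁻¹ , (begin
    (x * y) * (x⁻¹ * y⁻¹) ≈⟨ solve 4 (λ x y x⁻¹ y⁻¹ → ((x :* y) :* (x⁻¹ :* y⁻¹)) ⊜ ((x :* x⁻¹) :* (y :* y⁻¹)))
                                     refl x y x⁻¹ y⁻¹ ⟩
    (x * x⁻¹) * (y * y⁻¹) ≈⟨ *-cong xx⁻¹≈1 yy⁻¹≈1 ⟩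
    1# * 1#               ≈⟨ *-identityˡ 1# ⟩
    1#                    ∎))

  unit*x≈0⇒x≈0 : ∀ {u x} → IsUnit u → u * x ≈ 0# → x ≈ 0#
  unit*x≈0⇒x≈0 {u} {x} u-unit ux≈0 = begin
    x                       ≈⟨ inverse-cancelˡ u-unit x ⟨
    inverse u-unit * (u * x) ≈⟨ *-congˡ ux≈0 ⟩
    inverse u-unit * 0#      ≈⟨ zeroʳ _ ⟩
    0#                      ∎

  ~-sym : ∀ {n} {a b : Vec n} → a ~ b → b ~ a
  ~-sym {a = a} (t , t-unit , b≈ta) = inverse t-unit , inverse-unit t-unit ,
    λ i → lift (sym (trans (*-congˡ (lower (b≈ta i))) (inverse-cancelˡ t-unit (a i))))

  ~-respʳ-≋ : ∀ {n} {a b b′ : Vec n} → b ≋ b′ → a ~ b → a ~ b′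
  ~-respʳ-≋ b≋b′ (t , t-unit , b≈ta) =
    t , t-unit , λ i → lift (trans (sym (lower (b≋b′ i))) (lower (b≈ta i)))

  ≋-sym : ∀ {n} {a b : Vec n} → a ≋ b → b ≋ a
  ≋-sym a≋b i = lift (sym (lower (a≋b i)))

  ≋-trans : ∀ {n} {a b d : Vec n} → a ≋ b → b ≋ d → a ≋ d
  ≋-trans a≋b b≋d i = lift (trans (lower (a≋b i)) (lower (b≋d i)))

  lincomb-sub : ∀ {n d} (cs cs′ : Fin d → Carrier) (bs : Fin d → Vec n) i →
    lincomb cs bs i - lincomb cs′ bs i ≈ lincomb (λ j → cs j - cs′ j) bs i
  lincomb-sub {d = zero}  cs cs′ bs i = -‿inverseʳ 0#
  lincomb-sub {d = suc d} cs cs′ bs i = trans (+-sub-+ _ _ _ _)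
    (+-cong (sym ([y-z]x≈yx-zx (bs Fin.zero i) (cs Fin.zero) (cs′ Fin.zero)))
            (lincomb-sub (tail cs) (tail cs′) (tail bs) i))

module _ {c ℓ} (K : CommutativeRing c ℓ) (r : CommutativeRing.Carrier K)
         (finite : Ring.Finite K) (three-ideals : Ring.PreciselyThreeIdeals K r) where

  open CommutativeRing K
  open Ring K
  open import Algebra.Properties.Ring ring
    using ( -1*x≈-x; x[y-z]≈xy-xz; [y-z]x≈yx-zx; x∙y⁻¹≈ε⇒x≈y; x≈y⇒x∙y⁻¹≈ε
          ; ⁻¹-anti-homo‿-; xyx⁻¹≈y; -0#≈0#; -‿involutive)
  open import Relation.Binary.Reasoning.Setoid setoid
  open import Data.Maybe using (nothing)
  open import Tactic.RingSolver.Core.AlmostCommutativeRing using (fromCommutativeRing)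
  open import Tactic.RingSolver.NonReflective (fromCommutativeRing K (λ _ → nothing))
    using (solve; _⊜_) renaming (_⊕_ to _:+_; _⊗_ to _:*_)

  open CommutativeRingLemmas K

  J : Carrier → Set ℓ'
  J = ⟨ r ⟩

  module J = IsIdeal (principal r)

  r∈J : J r
  r∈J = lift (1# , sym (*-identityˡ r))

  J-*ʳ : ∀ {x} k → J x → J (x * k)
  J-*ʳ k x∈J = J.resp (*-comm k _) (J.*∈ k x∈J)

  J-neg : ∀ {x} → J x → J (- x)
  J-neg {x} x∈J = J.resp (-1*x≈-x x) (J.*∈ (- 1#) x∈J)

  infix 4 _≡ᴶ_
  _≡ᴶ_ : Carrier → Carrier → Set ℓ'
  x ≡ᴶ y = J (x - y)

  ≡ᴶ-reflexive : ∀ {x y} → x ≈ y → x ≡ᴶ y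
  ≡ᴶ-reflexive {x} {y} x≈y = J.resp (sym (x≈y⇒x∙y⁻¹≈ε x≈y)) J.zero∈

  ≡ᴶ-sym : ∀ {x y} → x ≡ᴶ y → y ≡ᴶ x
  ≡ᴶ-sym {x} {y} = J.resp (⁻¹-anti-homo‿- x y) ∘ J-neg

  ≡ᴶ-trans : ∀ {x y z} → x ≡ᴶ y → y ≡ᴶ z → x ≡ᴶ z
  ≡ᴶ-trans {x} {y} {z} x≡y y≡z =
    J.resp (sub-+-sub x y z) (J.+∈ x≡y y≡z)

  J? : ∀ x → Dec (J x)
  J? x with Any.any? (λ k → proj₁ finite x (k * r)) (proj₁ (proj₂ finite))
  ... | yes x≈kr = yes (lift (Any.lookup x≈kr , Anyₚ.lookup-result x≈kr))
  ... | no  x≉kr = no λ { (lift (k , x≈kr)) →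
    x≉kr (Any.map (λ k≈k′ → trans x≈kr (*-congʳ k≈k′)) (proj₂ (proj₂ finite) k)) }

  private
    classify = proj₁ three-ideals
    0≢J      = proj₁ (proj₂ three-ideals)
    J≢K      = proj₁ (proj₂ (proj₂ three-ideals))

  1∉J : ¬ J 1#
  1∉J 1∈J = J≢K (λ x → (λ _ → tt) , λ _ → J.resp (*-identityʳ x) (J.*∈ x 1∈J))

  r≉0 : ¬ r ≈ 0#
  r≉0 r≈0 = 0≢J (λ x → (λ { (lift x≈0) → J.resp (sym x≈0) J.zero∈ })
                     , λ { (lift (k , x≈kr)) → lift (trans x≈kr (trans (*-congˡ r≈0) (zeroʳ k))) })

  ∉J⇒unit : ∀ {x} → ¬ J x → IsUnit x
  ∉J⇒unit {x} x∉J with classify ⟨ x ⟩ (principal x)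
  ... | inj₁ ⟨x⟩≐0        = ⊥-elim (x∉J (J.resp (sym x≈0) J.zero∈))
    where x≈0 = lower (proj₁ (⟨x⟩≐0 x) (x∈⟨x⟩ x))
  ... | inj₂ (inj₁ ⟨x⟩≐J) = ⊥-elim (x∉J (proj₁ (⟨x⟩≐J x) (x∈⟨x⟩ x)))
  ... | inj₂ (inj₂ ⟨x⟩≐K) with lift (k , 1≈kx) ← proj₂ (⟨x⟩≐K 1#) tt =
    lift (k , trans (*-comm x k) (sym 1≈kx))

  unit⇒∉J : ∀ {x} → IsUnit x → ¬ J x
  unit⇒∉J (lift (y , xy≈1)) x∈J = 1∉J (J.resp xy≈1 (J-*ʳ y x∈J))

  unit+J-unit : ∀ {x y} → IsUnit x → J y → IsUnit (x + y)
  unit+J-unit {x} {y} x-unit y∈J =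
    ∉J⇒unit λ x+y∈J → unit⇒∉J x-unit (J.resp (+-sub-cancelʳ x y) (J.+∈ x+y∈J (J-neg y∈J)))

  unit*x∈J⇒x∈J : ∀ {w x} → IsUnit w → J (w * x) → J x
  unit*x∈J⇒x∈J {w} {x} w-unit wx∈J = J.resp (inverse-cancelˡ w-unit x) (J.*∈ (inverse w-unit) wx∈J)

  -- If ⟨r²⟩ = J then r = k r², so (1 - kr) r = 0 with 1 - kr a unit.
  r*r≈0 : r * r ≈ 0#
  r*r≈0 with classify ⟨ r * r ⟩ (principal (r * r))
  ... | inj₁ ⟨r²⟩≐0 = lower (proj₁ (⟨r²⟩≐0 (r * r)) (x∈⟨x⟩ (r * r)))
  ... | inj₂ (inj₂ ⟨r²⟩≐K) with lift (k , 1≈krr) ← proj₂ (⟨r²⟩≐K 1#) tt =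
    ⊥-elim (1∉J (lift (k * r , trans 1≈krr (sym (*-assoc k r r)))))
  ... | inj₂ (inj₁ ⟨r²⟩≐J) with lift (k , r≈krr) ← proj₂ (⟨r²⟩≐J r) r∈J =
    ⊥-elim (r≉0 (unit*x≈0⇒x≈0 (unit+J-unit 1-unit (J-neg (J.*∈ k r∈J))) (begin
      (1# - k * r) * r        ≈⟨ [y-z]x≈yx-zx r 1# (k * r) ⟩
      1# * r - (k * r) * r    ≈⟨ +-cong (*-identityˡ r) (-‿cong (*-assoc k r r)) ⟩
      r - k * (r * r)         ≈⟨ +-congˡ (-‿cong r≈krr) ⟨
      r - r                   ≈⟨ -‿inverseʳ r ⟩
      0#                      ∎)))

  J*J≈0 : ∀ {x y} → J x → J y → x * y ≈ 0#
  J*J≈0 {x} {y} (lift (a , x≈ar)) (lift (b , y≈br)) = begin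
    x * y             ≈⟨ *-cong x≈ar y≈br ⟩
    (a * r) * (b * r) ≈⟨ solve 3 (λ a b r → ((a :* r) :* (b :* r)) ⊜ ((a :* b) :* (r :* r))) refl a b r ⟩
    (a * b) * (r * r) ≈⟨ *-congˡ r*r≈0 ⟩
    (a * b) * 0#      ≈⟨ zeroʳ _ ⟩
    0#                ∎

  *r≈0⇒J : ∀ {k} → k * r ≈ 0# → J k
  *r≈0⇒J {k} kr≈0 with J? k
  ... | yes k∈J = k∈J
  ... | no  k∉J = ⊥-elim (r≉0 (unit*x≈0⇒x≈0 (∉J⇒unit k∉J) kr≈0))

  SamePoint : ∀ {n} → Vec n → Vec n → Set ℓ'
  SamePoint u x = ∃ λ μ → IsUnit μ × (∀ i → x i ≡ᴶ μ * u i)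

  SamePoint-sym : ∀ {n} {u x : Vec n} → SamePoint u x → SamePoint x u
  SamePoint-sym {u = u} {x} (μ , μ-unit , x≡μu) = inverse μ-unit , inverse-unit μ-unit ,
    λ i → ≡ᴶ-sym (J.resp (step i) (J.*∈ (inverse μ-unit) (x≡μu i)))
    where
    step : ∀ i → inverse μ-unit * (x i - μ * u i) ≈ inverse μ-unit * x i - u i
    step i = trans (x[y-z]≈xy-xz _ (x i) (μ * u i)) (+-congˡ (-‿cong (inverse-cancelˡ μ-unit (u i))))

  SamePoint-trans : ∀ {n} {u x y : Vec n} → SamePoint u x → SamePoint x y → SamePoint u y
  SamePoint-trans {u = u} {x} {y} (μ , μ-unit , x≡μu) (ν , ν-unit , y≡νx) =
    ν * μ , *-unit ν-unit μ-unit , λ i → J.resp (step i) (J.+∈ (y≡νx i) (J.*∈ ν (x≡μu i)))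
    where
    step : ∀ i → (y i - ν * x i) + ν * (x i - μ * u i) ≈ y i - (ν * μ) * u i
    step i = begin
      (y i - ν * x i) + ν * (x i - μ * u i)       ≈⟨ +-congˡ (x[y-z]≈xy-xz ν (x i) (μ * u i)) ⟩
      (y i - ν * x i) + (ν * x i - ν * (μ * u i)) ≈⟨ sub-+-sub (y i) (ν * x i) _ ⟩
      y i - ν * (μ * u i)                         ≈⟨ +-congˡ (-‿cong (*-assoc ν μ (u i))) ⟨
      y i - (ν * μ) * u i                         ∎

  SamePoint? : ∀ {n} (u x : Vec n) → Dec (SamePoint u x)
  SamePoint? u x with Any.any? (λ μ → ¬? (J? μ) ×-dec Finₚ.all? (λ i → J? (x i - μ * u i)))
                               (proj₁ (proj₂ finite))
  ... | yes found = let μ∉J , x≡μu = Anyₚ.lookup-result found in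
    yes (Any.lookup found , ∉J⇒unit μ∉J , x≡μu)
  ... | no  none  = no λ { (μ , μ-unit , x≡μu) → none (Any.map (λ μ≈μ′ →
    (λ μ′∈J → unit⇒∉J μ-unit (J.resp (sym μ≈μ′) μ′∈J)) ,
    (λ i → J.resp (+-congˡ (-‿cong (*-congʳ μ≈μ′))) (x≡μu i))) (proj₂ (proj₂ finite) μ)) }

  lincomb∈ : ∀ {n d} {H : Vec n → Set ℓ'} → IsSubspace r H →
    (cs : Fin d → Carrier) {bs : Fin d → Vec n} → (∀ j → H (bs j)) → H (lincomb cs bs)
  lincomb∈ {d = zero}  H-subspace cs bs∈H = IsSubspace.zero∈ H-subspace
  lincomb∈ {d = suc d} H-subspace cs bs∈H = IsSubspace.+∈ H-subspace
    (IsSubspace.·∈ H-subspace (cs Fin.zero) (bs∈H Fin.zero))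
    (lincomb∈ H-subspace (tail cs) (bs∈H ∘ Fin.suc))

  lincomb-J≋𝟎 : ∀ {n d} {cs : Fin d → Carrier} {bs : Fin d → Vec n} →
    (∀ j → J (cs j)) → (∀ j → T r (bs j)) → lincomb cs bs ≋ 𝟎
  lincomb-J≋𝟎 {d = zero}  cs∈J bs∈T i = lift refl
  lincomb-J≋𝟎 {d = suc d} cs∈J bs∈T i = lift (trans
    (+-cong (J*J≈0 (cs∈J Fin.zero) (bs∈T Fin.zero i))
            (lower (lincomb-J≋𝟎 (cs∈J ∘ Fin.suc) (bs∈T ∘ Fin.suc) i)))
    (+-identityʳ 0#))

  lincomb-cong-≡ᴶ : ∀ {n d} {cs cs′ : Fin d → Carrier} {bs : Fin d → Vec n} →
    (∀ j → cs j ≡ᴶ cs′ j) → (∀ j → T r (bs j)) → lincomb cs bs ≋ lincomb cs′ bs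
  lincomb-cong-≡ᴶ {cs = cs} {cs′} {bs} cs≡cs′ bs∈T i = lift (x∙y⁻¹≈ε⇒x≈y _ _
    (trans (lincomb-sub cs cs′ bs i) (lower (lincomb-J≋𝟎 cs≡cs′ bs∈T i))))

  basePoint : ∀ {n} → Index n r → Vec n
  basePoint (_ , _ , u , _) = u

  C⇒SamePoint : ∀ {n} (idx : Index n r) {x} → C idx x → SamePoint (basePoint idx) x
  C⇒SamePoint (H , (H-subspace , _) , u , _) {x} (h , h∈H , t , t-unit , x≈t[u+h]) =
    t , t-unit , λ i → J.resp (sym (step i)) (J.*∈ t (IsSubspace.⊆T H-subspace h∈H i))
    where
    step : ∀ i → x i - t * u i ≈ t * h i
    step i = begin
      x i - t * u i                 ≈⟨ +-congʳ (lower (x≈t[u+h] i)) ⟩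
      t * (u i + h i) - t * u i     ≈⟨ +-congʳ (distribˡ t (u i) (h i)) ⟩
      (t * u i + t * h i) - t * u i ≈⟨ xyx⁻¹≈y (t * u i) (t * h i) ⟩
      t * h i                       ∎

  module CoordinateHyperplane {m} (k : Fin (suc m)) where

    Hₖ : Vec (suc m) → Set ℓ'
    Hₖ x = T r x × Lift c (x k ≈ 0#)

    rₑ : Fin (suc m) → Vec (suc m)
    rₑ a i with a Fin.≟ i
    ... | yes _ = r
    ... | no  _ = 0#

    rₑ-≢ : ∀ {a i} → a ≢ i → rₑ a i ≈ 0#
    rₑ-≢ {a} {i} a≢i with a Fin.≟ i
    ... | yes a≡i = ⊥-elim (a≢i a≡i)
    ... | no  _   = refl

    rₑ-≡ : ∀ a → rₑ a a ≈ r
    rₑ-≡ a with a Fin.≟ a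
    ... | yes _   = refl
    ... | no  a≢a = ⊥-elim (a≢a ≡.refl)

    rₑ∈T : ∀ a → T r (rₑ a)
    rₑ∈T a i with a Fin.≟ i
    ... | yes _ = r∈J
    ... | no  _ = J.zero∈

    lincomb-rₑ-off : ∀ {d} (g : Fin d → Fin (suc m)) cs {i} → (∀ j → g j ≢ i) →
      lincomb cs (rₑ ∘ g) i ≈ 0#
    lincomb-rₑ-off {zero}  g cs g≢i = refl
    lincomb-rₑ-off {suc d} g cs g≢i = trans
      (+-cong (trans (*-congˡ (rₑ-≢ (g≢i Fin.zero))) (zeroʳ _))
              (lincomb-rₑ-off (tail g) (tail cs) (g≢i ∘ Fin.suc)))
      (+-identityʳ 0#)

    lincomb-rₑ-at : ∀ {d} (g : Fin d → Fin (suc m)) → (∀ {a b} → g a ≡ g b → a ≡ b) → ∀ cs j →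
      lincomb cs (rₑ ∘ g) (g j) ≈ cs j * r
    lincomb-rₑ-at g g-inj cs Fin.zero = trans
      (+-cong (*-congˡ (rₑ-≡ (g Fin.zero))) (lincomb-rₑ-off (tail g) (tail cs) (λ j → (λ ()) ∘ g-inj)))
      (+-identityʳ _)
    lincomb-rₑ-at g g-inj cs (Fin.suc j) = trans
      (+-cong (trans (*-congˡ (rₑ-≢ ((λ ()) ∘ g-inj))) (zeroʳ _))
              (lincomb-rₑ-at (tail g) (Finₚ.suc-injective ∘ g-inj) (tail cs) j))
      (+-identityˡ _)

    Hₖ-subspace : IsSubspace r Hₖ
    Hₖ-subspace = record
      { ⊆T    = proj₁
      ; resp  = λ { x≋y (x∈T , lift xₖ≈0) →
                    (λ i → J.resp (lower (x≋y i)) (x∈T i)) , lift (trans (sym (lower (x≋y k))) xₖ≈0) }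
      ; zero∈ = (λ _ → J.zero∈) , lift refl
      ; +∈    = λ { (x∈T , lift xₖ≈0) (y∈T , lift yₖ≈0) →
                    (λ i → J.+∈ (x∈T i) (y∈T i)) , lift (trans (+-cong xₖ≈0 yₖ≈0) (+-identityʳ 0#)) }
      ; ·∈    = λ { z (x∈T , lift xₖ≈0) →
                    (λ i → J.*∈ z (x∈T i)) , lift (trans (*-congˡ xₖ≈0) (zeroʳ z)) }
      }

    basis : Fin m → Vec (suc m)
    basis = rₑ ∘ punchIn k

    Hₖ-dimension : HasDimension r Hₖ m
    Hₖ-dimension = basis , basis∈Hₖ , independent , spanning
      where
      basis∈Hₖ : ∀ j → Hₖ (basis j)
      basis∈Hₖ j = rₑ∈T (punchIn k j) , lift (rₑ-≢ (Finₚ.punchInᵢ≢i k j))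
      independent : ∀ cs → lincomb cs basis ≋ 𝟎 → ∀ j → J (cs j)
      independent cs L≋𝟎 j = *r≈0⇒J (trans
        (sym (lincomb-rₑ-at (punchIn k) (Finₚ.punchIn-injective k _ _) cs j)) (lower (L≋𝟎 (punchIn k j))))
      spanning : ∀ h → Hₖ h → ∃ λ cs → h ≋ lincomb cs basis
      spanning h (h∈T , lift hₖ≈0) = cs , h≋L
        where
        cs : Fin m → Carrier
        cs j = proj₁ (lower (h∈T (punchIn k j)))
        h≋L : h ≋ lincomb cs basis
        h≋L i with k Fin.≟ i
        ... | yes ≡.refl = lift (trans hₖ≈0 (sym (lincomb-rₑ-off (punchIn k) cs (Finₚ.punchInᵢ≢i k))))
        ... | no  k≢i with j ← punchOut k≢i | ≡.refl ← Finₚ.punchIn-punchOut k≢i =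
          lift (trans (proj₂ (lower (h∈T (punchIn k j))))
                      (sym (lincomb-rₑ-at (punchIn k) (Finₚ.punchIn-injective k _ _) cs j)))

    index : (u : Vec (suc m)) → IsUnit (u k) → Index (suc m) r
    index u uₖ-unit = Hₖ , (Hₖ-subspace , Hₖ-dimension) , u , (k , uₖ-unit) , ru∉Hₖ
      where
      ru∉Hₖ : ¬ Hₖ (r ⊙ u)
      ru∉Hₖ (_ , lift ruₖ≈0) = unit⇒∉J uₖ-unit (*r≈0⇒J (trans (*-comm (u k) r) ruₖ≈0))

    u∈C[index] : (u : Vec (suc m)) (uₖ-unit : IsUnit (u k)) → C (index u uₖ-unit) u
    u∈C[index] u uₖ-unit = 𝟎 , IsSubspace.zero∈ Hₖ-subspace ,
      1# , 1-unit , λ i → lift (sym (trans (*-identityˡ _) (+-identityʳ (u i))))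

  C-covers : ∀ {m} (a : Vec (suc m)) → V' a → ∃ λ (idx : Index (suc m) r) → C idx a
  C-covers a (k , aₖ-unit) = index a aₖ-unit , u∈C[index] a aₖ-unit
    where open CoordinateHyperplane k

  basePoint∈V′ : ∀ {n} (idx : Index n r) → V' (basePoint idx)
  basePoint∈V′ (_ , _ , _ , u∈V′ , _) = u∈V′

  _≋?_ : ∀ {n} (a b : Vec n) → Dec (a ≋ b)
  a ≋? b with Finₚ.all? (λ i → proj₁ finite (a i) (b i))
  ... | yes a≈b = yes (lift ∘ a≈b)
  ... | no  a≉b = no (λ a≋b → a≉b (lower ∘ a≋b))

  ≡ᴶ⇒*r≈ : ∀ {a b} → a ≡ᴶ b → a * r ≈ b * r
  ≡ᴶ⇒*r≈ {a} {b} a≡b = x∙y⁻¹≈ε⇒x≈y _ _ (trans (sym ([y-z]x≈yx-zx r a b)) (J*J≈0 a≡b r∈J))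

  module _ {q} (quotient : QuotientSize r q) where

    private
      reps : List Carrier
      reps = proj₁ quotient

      reps-apart : AllPairs (λ x y → ¬ x ≡ᴶ y) reps
      reps-apart = proj₁ (proj₂ (proj₂ (proj₂ quotient)))

      reps-complete : ∀ x → Any (x ≡ᴶ_) reps
      reps-complete x = proj₂ (proj₂ (proj₂ (proj₂ quotient))) x tt

    length-tuples-reps : ∀ d → length (tuples reps d) ≡ q Nat.^ d
    length-tuples-reps d = ≡.trans (length-tuples reps d) (≡.cong (Nat._^ d) (proj₁ (proj₂ quotient)))

    T-enumerated : ∀ {n} x → T r x → Any (x ≋_) (map (r ⊙_) (tuples reps n))
    T-enumerated x x∈T = Anyₚ.map⁺ (Any.map (λ a≡ρ i → lift (trans (proj₂ (lower (x∈T i)))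
      (trans (≡ᴶ⇒*r≈ (a≡ρ i)) (*-comm _ r)))) (tuples-complete _≡ᴶ_ reps a (reps-complete ∘ a)))
      where
      a = λ i → proj₁ (lower (x∈T i))

    module Hyperplane {m n} {H : Vec n → Set ℓ'} (H-subspace : IsSubspace r H) (H-dim : HasDimension r H m) where

      open IsSubspace H-subspace public

      basis : Fin m → Vec n
      basis = proj₁ H-dim

      L : (Fin m → Carrier) → Vec n
      L cs = lincomb cs basis

      L∈H : ∀ cs → H (L cs)
      L∈H cs = lincomb∈ H-subspace cs (proj₁ (proj₂ H-dim))

      L-injective : ∀ {cs cs′} → L cs ≋ L cs′ → ∀ j → cs j ≡ᴶ cs′ j
      L-injective {cs} {cs′} L≋L = proj₁ (proj₂ (proj₂ H-dim)) _
        (λ i → lift (trans (sym (lincomb-sub cs cs′ basis i)) (x≈y⇒x∙y⁻¹≈ε (lower (L≋L i)))))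

      L-cong : ∀ {cs cs′} → (∀ j → cs j ≡ᴶ cs′ j) → L cs ≋ L cs′
      L-cong cs≡cs′ = lincomb-cong-≡ᴶ cs≡cs′ (⊆T ∘ proj₁ (proj₂ H-dim))

      ∈-sub : ∀ {x y} → H x → H y → H (λ i → x i - y i)
      ∈-sub {x} {y} x∈H y∈H = resp (λ i → lift (+-congˡ (-1*x≈-x (y i)))) (+∈ x∈H (·∈ (- 1#) y∈H))

      L-surjective : ∀ {h} → H h → ∃ λ cs → h ≋ L cs
      L-surjective = proj₂ (proj₂ (proj₂ H-dim)) _

    module Transversal {m} {H : Vec (suc m) → Set ℓ'} (H-subspace : IsSubspace r H) (H-dim : HasDimension r H m)
                       {u : Vec (suc m)} (ru∉H : ¬ H (r ⊙ u)) where

      open Hyperplane H-subspace H-dim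

      ru∈T : T r (r ⊙ u)
      ru∈T i = lift (u i , *-comm r (u i))

      ru-multiple∈H⇒J : ∀ {s D} → H D → D ≋ (s ⊙ (r ⊙ u)) → J s
      ru-multiple∈H⇒J {s} {D} D∈H D≋s·ru with J? s
      ... | yes s∈J = s∈J
      ... | no  s∉J = ⊥-elim (ru∉H (resp (λ i → lift (step i)) (·∈ (inverse s-unit) D∈H)))
        where
        s-unit = ∉J⇒unit s∉J
        step : ∀ i → inverse s-unit * D i ≈ r * u i
        step i = trans (*-congˡ (lower (D≋s·ru i))) (inverse-cancelˡ s-unit (r * u i))

      ru-multiple∈H⇒≋𝟎 : ∀ {s D} → H D → D ≋ (s ⊙ (r ⊙ u)) → D ≋ 𝟎
      ru-multiple∈H⇒≋𝟎 D∈H D≋s·ru i =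
        lift (trans (lower (D≋s·ru i)) (J*J≈0 (ru-multiple∈H⇒J D∈H D≋s·ru) (ru∈T i)))

      embed : Vector Carrier (suc m) → Vec (suc m)
      embed cs = L (tail cs) ⊕ (cs Fin.zero ⊙ (r ⊙ u))

      embed∈T : ∀ cs → T r (embed cs)
      embed∈T cs i = J.+∈ (⊆T (L∈H (tail cs)) i) (J.*∈ (cs Fin.zero) (ru∈T i))

      embed-injective : ∀ cs cs′ → embed cs ≋ embed cs′ → ∀ j → cs j ≡ᴶ cs′ j
      embed-injective cs cs′ e = λ
        { Fin.zero    → ≡ᴶ-sym (ru-multiple∈H⇒J D∈H D≋)
        ; (Fin.suc j) → L-injective (λ i → lift (x∙y⁻¹≈ε⇒x≈y _ _ (lower (ru-multiple∈H⇒≋𝟎 D∈H D≋ i)))) j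
        }
        where
        D = λ i → L (tail cs) i - L (tail cs′) i
        D∈H : H D
        D∈H = ∈-sub (L∈H (tail cs)) (L∈H (tail cs′))
        D≋ : D ≋ ((cs′ Fin.zero - cs Fin.zero) ⊙ (r ⊙ u))
        D≋ i = lift (trans (+≈+⇒-≈- (lower (e i))) (sym ([y-z]x≈yx-zx (r * u i) _ _)))

      decompose : ∀ d → T r d → ∃ λ h → ∃ λ s → H h × d ≋ (h ⊕ (s ⊙ (r ⊙ u)))
      decompose d d∈T = let cs , d≋embed = Any.satisfied (Anyₚ.map⁻ embeds-cover) in
        L (tail cs) , cs Fin.zero , L∈H (tail cs) , d≋embed
        where
        ts = tuples reps (suc m)
        embeds-apart : AllPairs (λ x y → ¬ x ≋ y) (map embed ts)
        embeds-apart = AllPairsₚ.map⁺ (AllPairs.map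
          (λ {cs} {cs′} (j , cⱼ≢c′ⱼ) e → cⱼ≢c′ⱼ (embed-injective cs cs′ e j)) (tuples-apart _ reps-apart (suc m)))
        embeds-cover : Any (d ≋_) (map embed ts)
        embeds-cover = pigeonhole-covers ≋-sym ≋-trans _≋?_ (map (r ⊙_) ts)
          (≡.trans (length-map _ ts) (≡.sym (length-map embed ts)))
          embeds-apart (Allₚ.map⁺ (All.universal embed∈T ts)) T-enumerated d d∈T

      -- If t(u + h) = u + h′ then t ≡ 1 (mod J), by looking at a unit coordinate of u;
      -- so h′ - h = (t - 1)u is a multiple of ru lying in H, which must vanish.
      translates-~⇒≋ : V' u → ∀ {h h′} → H h → H h′ → (u ⊕ h) ~ (u ⊕ h′) → h ≋ h′
      translates-~⇒≋ (k , uₖ-unit) {h} {h′} h∈H h′∈H (t , t-unit , u+h′≈t[u+h]) =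
        λ i → lift (sym (x∙y⁻¹≈ε⇒x≈y _ _ (lower (ru-multiple∈H⇒≋𝟎 (∈-sub h′∈H h∈H) D≋ i))))
        where
        s = t - 1#
        h′-h≈s[u+h] : ∀ i → h′ i - h i ≈ s * (u i + h i)
        h′-h≈s[u+h] i = begin
          h′ i - h i                          ≈⟨ +-sub-+-cancelˡ (u i) (h′ i) (h i) ⟨
          (u i + h′ i) - (u i + h i)          ≈⟨ +-congʳ (lower (u+h′≈t[u+h] i)) ⟩
          t * (u i + h i) - (u i + h i)       ≈⟨ +-congˡ (-‿cong (*-identityˡ _)) ⟨
          t * (u i + h i) - 1# * (u i + h i)  ≈⟨ [y-z]x≈yx-zx _ t 1# ⟨
          s * (u i + h i)                     ∎
        s∈J : J s
        s∈J = unit*x∈J⇒x∈J (unit+J-unit uₖ-unit (⊆T h∈H k))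
          (J.resp (trans (h′-h≈s[u+h] k) (*-comm s _)) (J.+∈ (⊆T h′∈H k) (J-neg (⊆T h∈H k))))
        a = proj₁ (lower s∈J)
        D≋ : (λ i → h′ i - h i) ≋ (a ⊙ (r ⊙ u))
        D≋ i = lift (begin
          h′ i - h i            ≈⟨ h′-h≈s[u+h] i ⟩
          s * (u i + h i)       ≈⟨ distribˡ s (u i) (h i) ⟩
          s * u i + s * h i     ≈⟨ +-congˡ (J*J≈0 s∈J (⊆T h∈H i)) ⟩
          s * u i + 0#          ≈⟨ +-identityʳ _ ⟩
          s * u i               ≈⟨ *-congʳ (proj₂ (lower s∈J)) ⟩
          (a * r) * u i         ≈⟨ *-assoc a r (u i) ⟩
          a * (r * u i)         ∎)

    -- Decompose μ⁻¹x - u = h + s·ru; as J² = 0 this gives x = μ(1 + sr)(u + h).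
    SamePoint⇒C : ∀ {m} (idx : Index (suc m) r) {x} → SamePoint (basePoint idx) x → C idx x
    SamePoint⇒C (H , (H-subspace , H-dim) , u , _ , ru∉H) {x} u~x@(μ , μ-unit , _) =
      h , h∈H , μ * (1# + s * r) , *-unit μ-unit (unit+J-unit 1-unit (J.*∈ s r∈J)) , λ i → lift (x≈ i)
      where
      open Hyperplane H-subspace H-dim using (⊆T)
      open Transversal H-subspace H-dim ru∉H using (decompose)
      d : Vec _
      d i = inverse μ-unit * x i - u i
      d∈T : T r d
      -- SamePoint-sym scales by inverse μ-unit, so it yields exactly u ≡ μ⁻¹x.
      d∈T i = ≡ᴶ-sym (proj₂ (proj₂ (SamePoint-sym u~x)) i)
      h = proj₁ (decompose d d∈T)
      s = proj₁ (proj₂ (decompose d d∈T))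
      h∈H = proj₁ (proj₂ (proj₂ (decompose d d∈T)))
      d≋h+s·ru = proj₂ (proj₂ (proj₂ (decompose d d∈T)))
      x≈ : ∀ i → x i ≈ (μ * (1# + s * r)) * (u i + h i)
      x≈ i = begin
        x i                               ≈⟨ inverse-cancelʳ μ-unit (x i) ⟨
        μ * (inverse μ-unit * x i)        ≈⟨ *-congˡ (+-sub-cancelˡ (u i) _) ⟨
        μ * (u i + d i)                   ≈⟨ *-congˡ (+-congˡ (lower (d≋h+s·ru i))) ⟩
        μ * (u i + (h i + s * (r * u i))) ≈⟨ *-congˡ ([1+sr][a+b]≈a+[b+s[ra]] s r (u i) (h i)
                                                      (J*J≈0 (J.*∈ s r∈J) (⊆T h∈H i))) ⟨
        μ * ((1# + s * r) * (u i + h i))  ≈⟨ *-assoc μ _ _ ⟨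
        (μ * (1# + s * r)) * (u i + h i)  ∎

    SamePoint⇒C≐C : ∀ {m} (i j : Index (suc m) r) → SamePoint (basePoint i) (basePoint j) → SameSet (C i) (C j)
    SamePoint⇒C≐C i j i~j x =
      (λ x∈Ci → SamePoint⇒C j (SamePoint-trans (SamePoint-sym i~j) (C⇒SamePoint i x∈Ci))) ,
      (λ x∈Cj → SamePoint⇒C i (SamePoint-trans i~j (C⇒SamePoint j x∈Cj)))

    C-equal-or-disjoint : ∀ {m} (i j : Index (suc m) r) → SameSet (C i) (C j) ⊎ (∀ a → C i a → C j a → ⊥)
    C-equal-or-disjoint i j with SamePoint? (basePoint i) (basePoint j)
    ... | yes i~j = inj₁ (SamePoint⇒C≐C i j i~j)
    ... | no  i≁j = inj₂ λ a a∈Ci a∈Cj →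
      i≁j (SamePoint-trans (C⇒SamePoint i a∈Ci) (SamePoint-sym (C⇒SamePoint j a∈Cj)))

    C-size : ∀ {m} (idx : Index (suc m) r) → HasSize (Vec (suc m)) _~_ (λ a → V' a × C idx a) (q Nat.^ m)
    C-size {m} idx@(H , (H-subspace , H-dim) , u , u∈V′@(k , uₖ-unit) , ru∉H) =
      map point ts , ≡.trans (length-map point ts) (length-tuples-reps m) ,
      Allₚ.map⁺ (All.universal point∈ ts) , points-apart , points-cover
      where
      open Hyperplane H-subspace H-dim
      open Transversal H-subspace H-dim ru∉H using (translates-~⇒≋)
      ts = tuples reps m
      point : (Fin m → Carrier) → Vec (suc m)
      point cs = u ⊕ L cs
      point∈ : ∀ cs → V' (point cs) × C idx (point cs)
      point∈ cs = (k , unit+J-unit uₖ-unit (⊆T (L∈H cs) k)) ,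
                  L cs , L∈H cs , 1# , 1-unit , λ i → lift (sym (*-identityˡ _))
      points-apart : AllPairs (λ x y → ¬ x ~ y) (map point ts)
      points-apart = AllPairsₚ.map⁺ (AllPairs.map (λ {cs} {cs′} (j , csⱼ≢cs′ⱼ) p~p′ →
        csⱼ≢cs′ⱼ (L-injective (translates-~⇒≋ u∈V′ (L∈H cs) (L∈H cs′) p~p′) j))
        (tuples-apart _ reps-apart m))
      points-cover : ∀ x → V' x × C idx x → Any (x ~_) (map point ts)
      points-cover x (_ , h , h∈H , u+h~x) = let cs , h≋Lcs = L-surjective h∈H in
        Anyₚ.map⁺ (Any.map
          (λ cs≡ρ → ~-respʳ-≋ (λ i → lift (+-congˡ (trans (lower (h≋Lcs i)) (lower (L-cong cs≡ρ i)))))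
                              (~-sym u+h~x))
          (tuples-complete _≡ᴶ_ reps cs (reps-complete ∘ cs)))

    ProjectivePoint : ℕ → Set ℓ'
    ProjectivePoint n = Σ (Vec n) V'

    Distinct : ∀ {n} → ProjectivePoint n → ProjectivePoint n → Set ℓ'
    Distinct a b = ¬ SamePoint (proj₁ a) (proj₁ b)

    affinePoint : ∀ {n} → Vector Carrier n → ProjectivePoint (suc n)
    affinePoint x = (1# ◂ x) , Fin.zero , 1-unit

    pointAtInfinity : ∀ {n} → ProjectivePoint n → ProjectivePoint (suc n)
    pointAtInfinity (p , i , pᵢ-unit) = (0# ◂ p) , Fin.suc i , pᵢ-unit

    affinePoint-distinct : ∀ {n} {x y : Vector Carrier n} →
      Apart (λ a b → ¬ a ≡ᴶ b) x y → Distinct (affinePoint x) (affinePoint y)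
    affinePoint-distinct {x = x} (j , xⱼ≢yⱼ) (μ , μ-unit , y≡μx) =
      xⱼ≢yⱼ (≡ᴶ-sym (≡ᴶ-trans (y≡μx (Fin.suc j)) μx≡x))
      where
      1≡μ : 1# ≡ᴶ μ
      1≡μ = J.resp (+-congˡ (-‿cong (*-identityʳ μ))) (y≡μx Fin.zero)
      μx≡x : μ * x j ≡ᴶ x j
      μx≡x = J.resp (trans ([y-z]x≈yx-zx (x j) μ 1#) (+-congˡ (-‿cong (*-identityˡ (x j)))))
                    (J-*ʳ (x j) (≡ᴶ-sym 1≡μ))

    affinePoint≢pointAtInfinity : ∀ {n} (x : Vector Carrier n) b → Distinct (affinePoint x) (pointAtInfinity b)
    affinePoint≢pointAtInfinity x b (μ , μ-unit , 0≡μ1) = unit⇒∉J μ-unit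
      (J.resp (trans (-‿cong (+-identityˡ _)) (trans (-‿involutive _) (*-identityʳ μ))) (J-neg (0≡μ1 Fin.zero)))

    projectivePoints : ∀ n → List (ProjectivePoint n)
    projectivePoints zero    = []
    projectivePoints (suc n) = map affinePoint (tuples reps n) ++ map pointAtInfinity (projectivePoints n)

    length-projectivePoints : ∀ n → length (projectivePoints n) ≡ geometricSum q n
    length-projectivePoints zero    = ≡.refl
    length-projectivePoints (suc n) = ≡.trans (length-++ (map affinePoint (tuples reps n)))
      (≡.cong₂ Nat._+_ (≡.trans (length-map affinePoint (tuples reps n)) (length-tuples-reps n))
                       (≡.trans (length-map pointAtInfinity (projectivePoints n)) (length-projectivePoints n)))

    projectivePoints-distinct : ∀ n → AllPairs Distinct (projectivePoints n)
    projectivePoints-distinct zero    = []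
    projectivePoints-distinct (suc n) = AllPairsₚ.++⁺
      (AllPairsₚ.map⁺ (AllPairs.map affinePoint-distinct (tuples-apart _ reps-apart n)))
      (AllPairsₚ.map⁺ (AllPairs.map (λ a≁b (μ , μ-unit , b≡μa) → a≁b (μ , μ-unit , b≡μa ∘ Fin.suc))
                                    (projectivePoints-distinct n)))
      (Allₚ.map⁺ (All.universal (λ x → Allₚ.map⁺ (All.universal (affinePoint≢pointAtInfinity x) _)) _))

    projectivePoints-complete : ∀ n (v : Vec n) → V' v → Any (λ a → SamePoint (proj₁ a) v) (projectivePoints n)
    projectivePoints-complete zero    v (() , _)
    projectivePoints-complete (suc n) v (k , vₖ-unit) with J? (v Fin.zero)
    ... | no v₀∉J = Anyₚ.++⁺ˡ (Anyₚ.map⁺ (Any.map (λ y≡ρ → v Fin.zero , v₀-unit , λ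
      { Fin.zero    → ≡ᴶ-reflexive (sym (*-identityʳ _))
      ; (Fin.suc j) → J.resp (trans (x[y-z]≈xy-xz _ (y j) _) (+-congʳ (inverse-cancelʳ v₀-unit _)))
                             (J.*∈ (v Fin.zero) (y≡ρ j)) })
      (tuples-complete _≡ᴶ_ reps y (reps-complete ∘ y))))
      where
      v₀-unit = ∉J⇒unit v₀∉J
      y : Vector Carrier n
      y j = inverse v₀-unit * v (Fin.suc j)
    ... | yes v₀∈J = Anyₚ.++⁺ʳ _ (Anyₚ.map⁺ (Any.map (λ (μ , μ-unit , tail≡μa) → μ , μ-unit , λ
      { Fin.zero    → J.resp (sym (trans (+-congˡ (trans (-‿cong (zeroʳ μ)) -0#≈0#)) (+-identityʳ _))) v₀∈J
      ; (Fin.suc i) → tail≡μa i })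
      (projectivePoints-complete n (tail v) (tail-unit k vₖ-unit))))
      where
      tail-unit : ∀ k → IsUnit (v k) → V' (tail v)
      tail-unit Fin.zero    v₀-unit = ⊥-elim (unit⇒∉J v₀-unit v₀∈J)
      tail-unit (Fin.suc k) vₖ-unit = k , vₖ-unit

    q-positive : ∃ λ p → q ≡ suc p
    q-positive = nonempty (reps-complete 0#) (proj₁ (proj₂ quotient))
      where
      nonempty : ∀ {xs : List Carrier} → Any (0# ≡ᴶ_) xs → length xs ≡ q → ∃ λ p → q ≡ suc p
      nonempty {_ ∷ xs} _ |xs|≡q = length xs , ≡.sym |xs|≡q

    geometricSum-*-[q∸1] : ∀ n → geometricSum q n Nat.* (q Nat.∸ 1) ≡ q Nat.^ n Nat.∸ 1
    geometricSum-*-[q∸1] n with p , ≡.refl ← q-positive = geometricSum-*-pred p n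

    C-count : ∀ m → ∃ λ N → HasSize (Index (suc m) r) (λ i j → SameSet (C i) (C j)) (λ _ → ⊤ {ℓ'}) N ×
                             N Nat.* (q Nat.∸ 1) ≡ q Nat.^ suc m Nat.∸ 1
    C-count m = geometricSum q (suc m) ,
      (map indexOf ps , ≡.trans (length-map indexOf ps) (length-projectivePoints (suc m)) ,
       All.universal _ _ , indices-apart , indices-cover) ,
      geometricSum-*-[q∸1] (suc m)
      where
      ps = projectivePoints (suc m)
      indexOf : ProjectivePoint (suc m) → Index (suc m) r
      indexOf (a , a∈V′) = proj₁ (C-covers a a∈V′)
      indices-apart : AllPairs (λ i j → ¬ SameSet (C i) (C j)) (map indexOf ps)
      indices-apart = AllPairsₚ.map⁺ (AllPairs.map (λ { {a , a∈V′} {b} a≁b Ca≐Cb →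
        a≁b (SamePoint-sym (C⇒SamePoint (indexOf b) (proj₁ (Ca≐Cb a) (proj₂ (C-covers a a∈V′))))) })
        (projectivePoints-distinct (suc m)))
      indices-cover : ∀ j → ⊤ → Any (λ i → SameSet (C j) (C i)) (map indexOf ps)
      indices-cover j _ = Anyₚ.map⁺ (Any.map (λ {a} a~j → SamePoint⇒C≐C j (indexOf a) (SamePoint-sym a~j))
        (projectivePoints-complete (suc m) (basePoint j) (basePoint∈V′ j)))

open import Data.Nat using (_≤_; _*_; _∸_; _^_)

corollary3p7 : ∀ {c ℓ} (K : CommutativeRing c ℓ) (r : CommutativeRing.Carrier K) (e q : ℕ) →
    2 ≤ e → Ring.Finite K → Ring.PreciselyThreeIdeals K r → Ring.QuotientSize K r q →
    -- the sets C(H,u) cover V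
    (∀ a → Ring.V' K a → ∃ λ (i : Ring.Index K (2 * e) r) → Ring.C K i a) ×
    -- any two of them coincide or are disjoint
    (∀ (i j : Ring.Index K (2 * e) r) →
       SameSet (Ring.C K i) (Ring.C K j) ⊎ (∀ a → Ring.C K i a → Ring.C K j a → ⊥)) ×
    -- each class has q^(2e-1) vertices
    (∀ (i : Ring.Index K (2 * e) r) →
       HasSize (Ring.Vec K (2 * e)) (Ring._~_ K) (λ a → Ring.V' K a × Ring.C K i a) (q ^ (2 * e ∸ 1))) ×
    -- the number N of distinct classes satisfies N (q - 1) = q^(2e) - 1
    (∃ λ N → HasSize (Ring.Index K (2 * e) r) (λ i j → SameSet (Ring.C K i) (Ring.C K j)) (λ _ → ⊤ {Ring.ℓ' K}) N ×
             N * (q ∸ 1) ≡ q ^ (2 * e) ∸ 1)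
corollary3p7 K r zero    q ()
corollary3p7 K r (suc e) q _ finite three-ideals quotient =
  C-covers K r finite three-ideals ,
  C-equal-or-disjoint K r finite three-ideals quotient ,
  C-size K r finite three-ideals quotient ,
  C-count K r finite three-ideals quotient _
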